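{- Fix integers $n\ge 1$, $0\le m\le \binom{n}{2}$ and $k\ge 1$. Let $P$ and $Q$ be finite collections (multisets) of $n$-vertex graphs with $m$ edges. If $\Delta_kX_P=\Delta_kX_Q$, then $d_kX_P=d_kX_Q$. In particular, the $k$-edge deck of a graph can be reconstructed from its modified $k$-deck.
   Context: All graphs are simple, undirected, with $n$ vertices. $U_j$ denotes the set of all unlabelled $n$-vertex graphs with exactly $j$ edges. For a multiset $P$ of $m$-edge graphs, $X_P$ is its characteristic vector indexed by $U_m$ (the entry at $F\in U_m$ is the number of members of $P$ isomorphic to $F$). $\Delta_k$ is the square matrix indexed by $U_m$ whose $(a,b)$-entry is the number of ways to obtain a graph isomorphic to $G_a\in U_m$ from $G_b\in U_m$ by removing a set $A$ of $k$ edges of $G_b$ and then adding a set of $k$ edges not present in $G_b-A$ (added edges need not differ from removed ones); $\Delta_kX_G$ is the modified $k$-deck of $G$. $d_k$ is the matrix with rows indexed by $F_a\in U_{m-k}$ and columns by $G_b\in U_m$, whose $(a,b)$-entry is the number of $k$-edge subsets of $E(G_b)$ whose deletion yields a graph isomorphic to $F_a$; $d_kX_G$ is the $k$-edge deck of $G$. -}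

module Defs where

open import Data.Bool using (Bool; true; false; _∧_; _∨_; not; if_then_else_)
open import Data.Nat using (ℕ; zero; suc; _+_; _<?_; _≡ᵇ_)
open import Data.Fin using (Fin; toℕ) renaming (_≟_ to _≟ᶠ_)
open import Data.List using (List; []; _∷_; _++_; map; filter; length; cartesianProduct; concatMap; allFin; zip)
open import Data.Bool.ListAction using (any; all)
open import Data.Nat.ListAction using (sum)
open import Data.Vec using (Vec; []; _∷_; lookup; toList; zipWith)
open import Data.Product using (_×_; _,_; proj₁; proj₂)
open import Relation.Nullary.Decidable using (⌊_⌋)

-- Vertex set is Fin n. Potential edges = unordered pairs {i,j}, i<j,
-- listed in a fixed order.
pairs : (n : ℕ) → List (Fin n × Fin n)
pairs n = filter (λ p → toℕ (proj₁ p) <? toℕ (proj₂ p)) (cartesianProduct (allFin n) (allFin n))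

numPairs : ℕ → ℕ
numPairs n = length (pairs n)

-- A simple graph on vertex set Fin n: its edge set, as a bit vector over pairs n.
-- (Also used for arbitrary edge subsets.)
record Graph (n : ℕ) : Set where
  constructor mkGraph
  field edgeSet : Vec Bool (numPairs n)
open Graph public

adj : {n : ℕ} → Graph n → Fin n → Fin n → Bool
adj {n} G a b = any (λ q → proj₁ q ∧ (eqP (proj₂ q))) (zip (toList (edgeSet G)) (pairs n))
  where
  eqP : Fin n × Fin n → Bool
  eqP (i , j) = (⌊ i ≟ᶠ a ⌋ ∧ ⌊ j ≟ᶠ b ⌋) ∨ (⌊ i ≟ᶠ b ⌋ ∧ ⌊ j ≟ᶠ a ⌋)

countTrue : {N : ℕ} → Vec Bool N → ℕ
countTrue [] = 0
countTrue (x ∷ xs) = (if x then 1 else 0) + countTrue xs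

edges : {n : ℕ} → Graph n → ℕ
edges G = countTrue (edgeSet G)

allSubsets : (N : ℕ) → List (Vec Bool N)
allSubsets zero = [] ∷ []
allSubsets (suc N) = map (true ∷_) (allSubsets N) ++ map (false ∷_) (allSubsets N)

_⊆ᵇ_ : {N : ℕ} → Vec Bool N → Vec Bool N → Bool
[] ⊆ᵇ [] = true
(x ∷ xs) ⊆ᵇ (y ∷ ys) = (not x ∨ y) ∧ (xs ⊆ᵇ ys)

disjointᵇ : {N : ℕ} → Vec Bool N → Vec Bool N → Bool
disjointᵇ [] [] = true
disjointᵇ (x ∷ xs) (y ∷ ys) = not (x ∧ y) ∧ disjointᵇ xs ys

_∖_ : {N : ℕ} → Vec Bool N → Vec Bool N → Vec Bool N
G ∖ A = zipWith (λ g a → g ∧ not a) G A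

_∪_ : {N : ℕ} → Vec Bool N → Vec Bool N → Vec Bool N
G ∪ B = zipWith _∨_ G B

allVecs : {A : Set} → List A → (k : ℕ) → List (Vec A k)
allVecs xs zero = [] ∷ []
allVecs xs (suc k) = concatMap (λ x → map (x ∷_) (allVecs xs k)) xs

allMaps : (n : ℕ) → List (Vec (Fin n) n)
allMaps n = allVecs (allFin n) n

_==ᵇ_ : Bool → Bool → Bool
true ==ᵇ b = b
false ==ᵇ b = not b

injᵇ : {n : ℕ} → Vec (Fin n) n → Bool
injᵇ {n} f = all (λ a → all (λ b → not ⌊ lookup f a ≟ᶠ lookup f b ⌋ ∨ ⌊ a ≟ᶠ b ⌋) (allFin n)) (allFin n)

isoᵇ : {n : ℕ} → Graph n → Graph n → Bool
isoᵇ {n} G H = any (λ f → injᵇ f ∧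
  all (λ a → all (λ b → adj G a b ==ᵇ adj H (lookup f a) (lookup f b)) (allFin n)) (allFin n))
  (allMaps n)

countL : {A : Set} → (A → Bool) → List A → ℕ
countL p xs = length (filter (λ x → p x Data.Bool.≟ true) xs)
  where import Data.Bool

-- number of k-edge subsets A ⊆ E(G) with G - A ≅ F   (entry of d_k)
dEntry : {n : ℕ} → ℕ → Graph n → Graph n → ℕ
dEntry {n} k F G =
  countL (λ A → (A ⊆ᵇ edgeSet G) ∧ (countTrue A ≡ᵇ k) ∧ isoᵇ (mkGraph (edgeSet G ∖ A)) F)
         (allSubsets (numPairs n))

-- number of ways to remove a k-set A ⊆ E(G) and add a k-set B of edges
-- not in G - A so that the result is ≅ F   (entry of Δ_k)
ΔEntry : {n : ℕ} → ℕ → Graph n → Graph n → ℕ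
ΔEntry {n} k F G =
  sum (map (λ A → if (A ⊆ᵇ edgeSet G) ∧ (countTrue A ≡ᵇ k)
                  then countL (λ B → (countTrue B ≡ᵇ k) ∧ disjointᵇ B (edgeSet G ∖ A)
                                     ∧ isoᵇ (mkGraph ((edgeSet G ∖ A) ∪ B)) F)
                              (allSubsets (numPairs n))
                  else 0)
           (allSubsets (numPairs n)))

-- (d_k X_P) at (the isomorphism class of) F, for a multiset P given as a list
dX : {n : ℕ} → ℕ → List (Graph n) → Graph n → ℕ
dX k P F = sum (map (dEntry k F) P)

ΔX : {n : ℕ} → ℕ → List (Graph n) → Graph n → ℕ
ΔX k P F = sum (map (ΔEntry k F) P)

-- Work with labelled edge sets on the vertex set Fin n. Let d(H, G) count the k-subsets
-- A ⊆ G with G ∖ A ≅ H, let u(T, H) count the k-sets B disjoint from H with H ∪ B ≅ T, and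
-- let c(X) be the size of the isomorphism class of X. Counting the pairs (G, A) with G ≅ T,
-- A a k-subset of G and G ∖ A ≅ H in two ways gives c(H) u(T, H) = c(T) d(H, T). With
-- W = ∏ c(X) and the weights w(X) = W / c(X) this reads w(T) u(T, H) = w(H) d(H, T), and
-- testing the modified deck of P against w on a multiset R yields a symmetric bilinear form
-- in the k-edge decks:
--   W · Σ_{T ∈ R} w(T) (Δ_k X_P)(T) = ⟨P, R⟩ := Σ_H w(H)² (d_k X_P)(H) (d_k X_R)(H).
-- Hence Δ_k X_P = Δ_k X_Q gives ⟨P, R⟩ = ⟨Q, R⟩ for R = P and R = Q, so
-- Σ_H w(H)² ((d_k X_P)(H) − (d_k X_Q)(H))² = ⟨P, P⟩ + ⟨Q, Q⟩ − 2 ⟨P, Q⟩ = 0.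
module Submission where

open import Defs
open import Data.Bool using (Bool; true; false; _∧_; _∨_; not; if_then_else_; T)
import Data.Bool.Properties as Bool
open import Data.Bool.Properties using (T-∧; T-∨; ∨-comm; ∧-zeroʳ; ∧-identityʳ; ∨-identityʳ)
open import Data.Bool.ListAction using (any; all; or)
open import Data.Empty using (⊥-elim)
open import Data.Fin using (Fin; zero; suc; toℕ; punchOut) renaming (_≟_ to _≟ᶠ_)
open import Data.Fin.Permutation using (Permutation′; permutation; _⟨$⟩ʳ_; inverseˡ; inverseʳ; flip; _∘ₚ_)
import Data.Fin.Permutation as Permutation
open import Data.Fin.Properties using (suc-injective; toℕ-injective; injective⇒≤; punchOut-injective; any?)
open import Data.List using (List; []; _∷_; _++_; map; length; zip; allFin; cartesianProduct)
import Data.List as List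
open import Data.List.Membership.Propositional using (_∈_)
open import Data.List.Membership.Propositional.Properties
  using (∈-lookup; ∈-filter⁺; ∈-filter⁻; ∈-cartesianProduct⁺; ∈-allFin; ∈-map⁺; ∈-concat⁺′;
         ∈-++⁺ˡ; ∈-++⁺ʳ)
open import Data.List.Properties using (map-cong; map-∘; map-++)
open import Data.List.Relation.Unary.All as All using (All; []; _∷_)
open import Data.List.Relation.Unary.All.Properties using (all⁺; all⁻)
open import Data.List.Relation.Unary.AllPairs using (_∷_)
open import Data.List.Relation.Unary.Any as Any using (here; there; index; satisfied)
open import Data.List.Relation.Unary.Any.Properties using (any⁺; any⁻; lookup-index)
open import Data.List.Relation.Unary.Unique.Propositional using (Unique)
import Data.List.Relation.Unary.Unique.Propositional.Properties as Unique
open import Data.Nat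
  using (ℕ; zero; suc; z≤n; _+_; _*_; _^_; _∸_; _<_; _<?_; _≤_; _≡ᵇ_; ∣_-_∣; NonZero; >-nonZero)
open import Data.Nat.Combinatorics using (_C_)
open import Data.Nat.ListAction using (sum; product)
open import Data.Nat.ListAction.Properties using (sum-++; product-++)
import Data.Nat.Properties as ℕ
open import Algebra.Properties.CommutativeSemigroup ℕ.+-commutativeSemigroup
  using () renaming (interchange to +-interchange)
import Algebra.Properties.CommutativeSemigroup ℕ.*-commutativeSemigroup as *
open import Data.Nat.Tactic.RingSolver using (solve-∀)
open import Data.Product using (_×_; _,_; proj₁; proj₂; ∃-syntax)
open import Data.Sum using (_⊎_; inj₁; inj₂; [_,_]′)
open import Data.Vec using (Vec; []; _∷_; lookup; toList; tabulate; zipWith)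
open import Data.Vec.Properties using (lookup∘tabulate; lookup-zipWith; ≡-dec)
open import Data.Vec.Relation.Binary.Pointwise.Extensional using (ext; Pointwise-≡⇒≡)
open import Function using (_∘_; id; Injective; Injection; Equivalence; _⇔_; mk⇔)
open import Function.Properties.Inverse using (↔⇒↣)
open import Relation.Binary.Definitions using (DecidableEquality; tri<; tri≈; tri>)
open import Relation.Binary.PropositionalEquality
open import Relation.Nullary using (¬_; yes; no; does; contradiction)
open import Relation.Nullary.Decidable using (⌊_⌋; toWitness; fromWitness; does-⇔)

private
  variable
    A B : Set

lookup-ext : ∀ {N} {xs ys : Vec A N} → (∀ i → lookup xs i ≡ lookup ys i) → xs ≡ ys
lookup-ext eq = Pointwise-≡⇒≡ (ext eq)

Unique-lookup-injective : ∀ {xs : List A} → Unique xs → ∀ {i j} → List.lookup xs i ≡ List.lookup xs j → i ≡ j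
Unique-lookup-injective {xs = _ ∷ _}  _          {zero}  {zero}  _  = refl
Unique-lookup-injective {xs = _ ∷ xs} (x∉ ∷ _)   {zero}  {suc j} eq =
  ⊥-elim (All.lookup x∉ (∈-lookup {xs = xs} j) eq)
Unique-lookup-injective {xs = _ ∷ xs} (x∉ ∷ _)   {suc i} {zero}  eq =
  ⊥-elim (All.lookup x∉ (∈-lookup {xs = xs} i) (sym eq))
Unique-lookup-injective {xs = _ ∷ _}  (_ ∷ uniq) {suc i} {suc j} eq = cong suc (Unique-lookup-injective uniq eq)

T-ext : ∀ {b c} → (T b → T c) → (T c → T b) → b ≡ c
T-ext {false} {false} _   _   = refl
T-ext {false} {true}  _   c⇒b = ⊥-elim (c⇒b _)
T-ext {true}  {false} b⇒c _   = ⊥-elim (b⇒c _)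
T-ext {true}  {true}  _   _   = refl

==ᵇ-sound : ∀ {x y} → T (x ==ᵇ y) → x ≡ y
==ᵇ-sound {true}  {true}  _ = refl
==ᵇ-sound {false} {false} _ = refl

==ᵇ-complete : ∀ {x y} → x ≡ y → T (x ==ᵇ y)
==ᵇ-complete {true}  refl = _
==ᵇ-complete {false} refl = _

T-all-allFin⁻ : ∀ {n} {p : Fin n → Bool} → T (all p (allFin n)) → ∀ a → T (p a)
T-all-allFin⁻ {n} {p} h a = All.lookup (all⁺ p (allFin n) h) (∈-allFin a)

T-all-allFin⁺ : ∀ {n} {p : Fin n → Bool} → (∀ a → T (p a)) → T (all p (allFin n))
T-all-allFin⁺ {n} {p} h = all⁻ p {allFin n} (All.tabulate λ {a} _ → h a)

allVecs-complete : ∀ {xs : List A} → (∀ x → x ∈ xs) → ∀ {k} (v : Vec A k) → v ∈ allVecs xs k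
allVecs-complete every []      = here refl
allVecs-complete every (x ∷ v) = ∈-concat⁺′ (∈-map⁺ (x ∷_) (allVecs-complete every v)) (∈-map⁺ _ (every x))

module _ (e : B → Bool) where

  anyMarked : ∀ (ps : List B) → Vec Bool (length ps) → Bool
  anyMarked ps xs = any (λ q → proj₁ q ∧ e (proj₂ q)) (zip (toList xs) ps)

  anyMarked-none : ∀ ps (xs : Vec Bool (length ps)) → (∀ i → ¬ T (e (List.lookup ps i))) →
    anyMarked ps xs ≡ false
  anyMarked-none []       []       _    = refl
  anyMarked-none (p ∷ ps) (x ∷ xs) none with e p | none zero
  ... | true  | ¬ep = contradiction _ ¬ep
  ... | false | _   rewrite ∧-zeroʳ x = anyMarked-none ps xs (none ∘ suc)

  anyMarked-unique : ∀ ps (xs : Vec Bool (length ps)) i → T (e (List.lookup ps i)) →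
    (∀ j → T (e (List.lookup ps j)) → j ≡ i) → anyMarked ps xs ≡ lookup xs i
  anyMarked-unique (p ∷ ps) (x ∷ xs) zero ep only with e p
  ... | true rewrite ∧-identityʳ x
                   | anyMarked-none ps xs (λ j ej → contradiction (only (suc j) ej) λ ()) = ∨-identityʳ x
  anyMarked-unique (p ∷ ps) (x ∷ xs) (suc i) ei only with e p | only zero
  ... | true  | zero≡i = contradiction (zero≡i _) λ ()
  ... | false | _ rewrite ∧-zeroʳ x = anyMarked-unique ps xs i ei (λ j ej → suc-injective (only (suc j) ej))

injᵇ-sound : ∀ {n} (f : Vec (Fin n) n) → T (injᵇ f) → Injective _≡_ _≡_ (lookup f)
injᵇ-sound f h {a} {b} fa≡fb with lookup f a ≟ᶠ lookup f b | a ≟ᶠ b | T-all-allFin⁻ (T-all-allFin⁻ h a) b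
... | _        | yes a≡b | _ = a≡b
... | no fa≢fb | no _    | _ = contradiction fa≡fb fa≢fb

injᵇ-complete : ∀ {n} (f : Vec (Fin n) n) → Injective _≡_ _≡_ (lookup f) → T (injᵇ f)
injᵇ-complete f inj = T-all-allFin⁺ λ a → T-all-allFin⁺ λ b → separated a b
  where
  separated : ∀ a b → T (not ⌊ lookup f a ≟ᶠ lookup f b ⌋ ∨ ⌊ a ≟ᶠ b ⌋)
  separated a b with lookup f a ≟ᶠ lookup f b | a ≟ᶠ b
  ... | yes _     | yes _  = _
  ... | no _      | _      = _
  ... | yes fa≡fb | no a≢b = a≢b (inj fa≡fb)

injective⇒surjective : ∀ {n} (f : Fin n → Fin n) → Injective _≡_ _≡_ f → ∀ y → ∃[ x ] f x ≡ y
injective⇒surjective {suc n} f inj y with any? (λ x → f x ≟ᶠ y)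
... | yes hit   = hit
... | no missed = contradiction (injective⇒≤ punchOut∘f-injective) ℕ.1+n≰n
  where
  y≢f : ∀ x → y ≢ f x
  y≢f x y≡fx = missed (x , sym y≡fx)
  punchOut∘f-injective : Injective _≡_ _≡_ (λ x → punchOut (y≢f x))
  punchOut∘f-injective eq = inj (punchOut-injective (y≢f _) (y≢f _) eq)

injection⇒permutation : ∀ {n} (f : Fin n → Fin n) → Injective _≡_ _≡_ f → Permutation′ n
injection⇒permutation f inj = permutation f (proj₁ ∘ onto) (proj₂ ∘ onto) (λ x → inj (proj₂ (onto (f x))))
  where
  onto : ∀ y → ∃[ x ] f x ≡ y
  onto = injective⇒surjective f inj

∑ : List A → (A → ℕ) → ℕ
∑ xs f = sum (map f xs)

∏ : List A → (A → ℕ) → ℕ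
∏ xs f = product (map f xs)

infix 5 ∑ ∏
syntax ∑ xs (λ x → e) = ∑[ x ∈ xs ] e
syntax ∏ xs (λ x → e) = ∏[ x ∈ xs ] e

∑-cong : ∀ (xs : List A) {f g : A → ℕ} → (∀ x → f x ≡ g x) → ∑ xs f ≡ ∑ xs g
∑-cong xs f≗g = cong sum (map-cong f≗g xs)

∑-congᴬ : ∀ {xs : List A} {f g : A → ℕ} → All (λ x → f x ≡ g x) xs → ∑ xs f ≡ ∑ xs g
∑-congᴬ []            = refl
∑-congᴬ (fx≡gx ∷ f≗g) = cong₂ _+_ fx≡gx (∑-congᴬ f≗g)

∑-zero : ∀ (xs : List A) → ∑[ x ∈ xs ] 0 ≡ 0
∑-zero []       = refl
∑-zero (_ ∷ xs) = ∑-zero xs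

∑²-zero : ∀ (xs : List A) (ys : List B) → ∑[ x ∈ xs ] ∑[ y ∈ ys ] 0 ≡ 0
∑²-zero xs ys = trans (∑-cong xs (λ _ → ∑-zero ys)) (∑-zero xs)

∑-+ : ∀ (xs : List A) (f g : A → ℕ) → ∑[ x ∈ xs ] (f x + g x) ≡ ∑ xs f + ∑ xs g
∑-+ []       f g = refl
∑-+ (x ∷ xs) f g = trans (cong (f x + g x +_) (∑-+ xs f g)) (+-interchange (f x) (g x) (∑ xs f) (∑ xs g))

∑-*ˡ : ∀ (xs : List A) c (f : A → ℕ) → ∑[ x ∈ xs ] c * f x ≡ c * ∑ xs f
∑-*ˡ []       c f = sym (ℕ.*-zeroʳ c)
∑-*ˡ (x ∷ xs) c f = trans (cong (c * f x +_) (∑-*ˡ xs c f)) (sym (ℕ.*-distribˡ-+ c (f x) (∑ xs f)))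

∑-*ʳ : ∀ (xs : List A) c (f : A → ℕ) → ∑[ x ∈ xs ] f x * c ≡ ∑ xs f * c
∑-*ʳ xs c f = trans (∑-cong xs (λ x → ℕ.*-comm (f x) c)) (trans (∑-*ˡ xs c f) (ℕ.*-comm c (∑ xs f)))

∑-++ : ∀ (xs ys : List A) (f : A → ℕ) → ∑ (xs ++ ys) f ≡ ∑ xs f + ∑ ys f
∑-++ xs ys f = trans (cong sum (map-++ f xs ys)) (sum-++ (map f xs) (map f ys))

∏-++ : ∀ (xs ys : List A) (f : A → ℕ) → ∏ (xs ++ ys) f ≡ ∏ xs f * ∏ ys f
∏-++ xs ys f = trans (cong product (map-++ f xs ys)) (product-++ (map f xs) (map f ys))

∑-map : ∀ (xs : List B) (g : B → A) (f : A → ℕ) → ∑ (map g xs) f ≡ ∑ xs (f ∘ g)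
∑-map xs g f = cong sum (sym (map-∘ xs))

∏-map : ∀ (xs : List B) (g : B → A) (f : A → ℕ) → ∏ (map g xs) f ≡ ∏ xs (f ∘ g)
∏-map xs g f = cong product (sym (map-∘ xs))

∑-comm : ∀ (xs : List A) (ys : List B) (f : A → B → ℕ) →
  ∑[ x ∈ xs ] ∑[ y ∈ ys ] f x y ≡ ∑[ y ∈ ys ] ∑[ x ∈ xs ] f x y
∑-comm []       ys f = sym (∑-zero ys)
∑-comm (x ∷ xs) ys f =
  trans (cong (∑ ys (f x) +_) (∑-comm xs ys f)) (sym (∑-+ ys (f x) (λ y → ∑[ x ∈ xs ] f x y)))

∑-mono : ∀ (xs : List A) {f g : A → ℕ} → (∀ x → f x ≤ g x) → ∑ xs f ≤ ∑ xs g
∑-mono []       f≤g = z≤n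
∑-mono (x ∷ xs) f≤g = ℕ.+-mono-≤ (f≤g x) (∑-mono xs f≤g)

+-mono-≡ : ∀ {a b c d} → a ≤ b → c ≤ d → a + c ≡ b + d → a ≡ b × c ≡ d
+-mono-≡ {a} {b} {c} {d} a≤b c≤d eq = a≡b , ℕ.+-cancelˡ-≡ a c d (trans eq (cong (_+ d) (sym a≡b)))
  where
  a≡b : a ≡ b
  a≡b = ℕ.≤-antisym a≤b
    (ℕ.+-cancelʳ-≤ c b a (ℕ.≤-trans (ℕ.+-monoʳ-≤ b c≤d) (ℕ.≤-reflexive (sym eq))))

∑-mono-≡ : ∀ {xs : List A} {f g : A → ℕ} → (∀ x → f x ≤ g x) → ∑ xs f ≡ ∑ xs g →
  ∀ {x} → x ∈ xs → f x ≡ g x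
∑-mono-≡ {xs = x ∷ xs} f≤g eq (here refl) = proj₁ (+-mono-≡ (f≤g x) (∑-mono xs f≤g) eq)
∑-mono-≡ {xs = x ∷ xs} f≤g eq (there y∈)  =
  ∑-mono-≡ f≤g (proj₂ (+-mono-≡ (f≤g x) (∑-mono xs f≤g) eq)) y∈

∑-member-≤ : ∀ {xs : List A} (f : A → ℕ) {x} → x ∈ xs → f x ≤ ∑ xs f
∑-member-≤             f (here refl) = ℕ.m≤m+n _ _
∑-member-≤ {xs = y ∷ _} f (there x∈) = ℕ.≤-trans (∑-member-≤ f x∈) (ℕ.m≤n+m _ (f y))

∏-nonZero : ∀ (xs : List A) {f : A → ℕ} → (∀ x → NonZero (f x)) → NonZero (∏ xs f)
∏-nonZero []       f≢0 = _
∏-nonZero (x ∷ xs) f≢0 = ℕ.m*n≢0 _ _ {{f≢0 x}} {{∏-nonZero xs f≢0}}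

ind : Bool → ℕ
ind b = if b then 1 else 0

ind-∧ : ∀ a b → ind (a ∧ b) ≡ ind a * ind b
ind-∧ true  b = sym (ℕ.*-identityˡ (ind b))
ind-∧ false b = refl

ind-∧³ : ∀ a b c → ind (a ∧ b ∧ c) ≡ ind a * (ind b * ind c)
ind-∧³ a b c = trans (ind-∧ a (b ∧ c)) (cong (ind a *_) (ind-∧ b c))

ind-T : ∀ {b} → T b → ind b ≡ 1
ind-T {true} _ = refl

ind*-cong : ∀ b {x y} → (T b → x ≡ y) → ind b * x ≡ ind b * y
ind*-cong true  x≡y = cong (1 *_) (x≡y _)
ind*-cong false _   = refl

if≡ind* : ∀ b x → (if b then x else 0) ≡ ind b * x
if≡ind* true  x = sym (ℕ.*-identityˡ x)
if≡ind* false x = refl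

countL≡∑ind : ∀ (p : A → Bool) xs → countL p xs ≡ ∑[ x ∈ xs ] ind (p x)
countL≡∑ind p []       = refl
countL≡∑ind p (x ∷ xs) with p x
... | true  = cong suc (countL≡∑ind p xs)
... | false = countL≡∑ind p xs

_≟ᵛ_ : ∀ {N} → DecidableEquality (Vec Bool N)
_≟ᵛ_ = ≡-dec Bool._≟_

allSubsets-complete : ∀ {N} (X : Vec Bool N) → X ∈ allSubsets N
allSubsets-complete []          = here refl
allSubsets-complete (true ∷ X)  = ∈-++⁺ˡ (∈-map⁺ (true ∷_) (allSubsets-complete X))
allSubsets-complete (false ∷ X) = ∈-++⁺ʳ _ (∈-map⁺ (false ∷_) (allSubsets-complete X))

∑-allSubsets-suc : ∀ N (f : Vec Bool (suc N) → ℕ) →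
  ∑ (allSubsets (suc N)) f ≡ (∑[ X ∈ allSubsets N ] f (true ∷ X)) + (∑[ X ∈ allSubsets N ] f (false ∷ X))
∑-allSubsets-suc N f = trans (∑-++ (map (true ∷_) (allSubsets N)) _ f)
  (cong₂ _+_ (∑-map (allSubsets N) (true ∷_) f) (∑-map (allSubsets N) (false ∷_) f))

∏-allSubsets-suc : ∀ N (f : Vec Bool (suc N) → ℕ) →
  ∏ (allSubsets (suc N)) f ≡ (∏[ X ∈ allSubsets N ] f (true ∷ X)) * (∏[ X ∈ allSubsets N ] f (false ∷ X))
∏-allSubsets-suc N f = trans (∏-++ (map (true ∷_) (allSubsets N)) _ f)
  (cong₂ _*_ (∏-map (allSubsets N) (true ∷_) f) (∏-map (allSubsets N) (false ∷_) f))

∑²-allSubsets-suc : ∀ N (f : Vec Bool (suc N) → Vec Bool (suc N) → ℕ) →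
  ∑[ X ∈ allSubsets (suc N) ] ∑[ Y ∈ allSubsets (suc N) ] f X Y ≡
    ((∑[ X ∈ allSubsets N ] ∑[ Y ∈ allSubsets N ] f (true ∷ X) (true ∷ Y)) +
     (∑[ X ∈ allSubsets N ] ∑[ Y ∈ allSubsets N ] f (true ∷ X) (false ∷ Y))) +
    ((∑[ X ∈ allSubsets N ] ∑[ Y ∈ allSubsets N ] f (false ∷ X) (true ∷ Y)) +
     (∑[ X ∈ allSubsets N ] ∑[ Y ∈ allSubsets N ] f (false ∷ X) (false ∷ Y)))
∑²-allSubsets-suc N f = trans (∑-allSubsets-suc N _) (cong₂ _+_ (splitInner true) (splitInner false))
  where
  S : List (Vec Bool N)
  S = allSubsets N
  splitInner : ∀ x → ∑[ X ∈ S ] ∑ (allSubsets (suc N)) (f (x ∷ X)) ≡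
    (∑[ X ∈ S ] ∑[ Y ∈ S ] f (x ∷ X) (true ∷ Y)) + (∑[ X ∈ S ] ∑[ Y ∈ S ] f (x ∷ X) (false ∷ Y))
  splitInner x = trans (∑-cong S (λ X → ∑-allSubsets-suc N (f (x ∷ X)))) (∑-+ S _ _)

∑-allSubsets-δ : ∀ {N} (Z : Vec Bool N) (g : Vec Bool N → ℕ) →
  ∑[ X ∈ allSubsets N ] ind (does (X ≟ᵛ Z)) * g X ≡ g Z
∑-allSubsets-δ             []          g = trans (ℕ.+-identityʳ _) (ℕ.+-identityʳ (g []))
∑-allSubsets-δ {N = suc N} (true ∷ Z)  g =
  trans (∑-allSubsets-suc N (λ X → ind (does (X ≟ᵛ (true ∷ Z))) * g X))
        (trans (cong₂ _+_ (∑-allSubsets-δ Z (g ∘ (true ∷_))) (∑-zero (allSubsets N))) (ℕ.+-identityʳ _))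
∑-allSubsets-δ {N = suc N} (false ∷ Z) g =
  trans (∑-allSubsets-suc N (λ X → ind (does (X ≟ᵛ (false ∷ Z))) * g X))
        (cong₂ _+_ (∑-zero (allSubsets N)) (∑-allSubsets-δ Z (g ∘ (false ∷_))))

∏-allSubsets-δ : ∀ {N} (Z : Vec Bool N) (g : Vec Bool N → ℕ) →
  (∏[ X ∈ allSubsets N ] (if does (X ≟ᵛ Z) then 1 else g X)) * g Z ≡ ∏ (allSubsets N) g
∏-allSubsets-δ             []          g = trans (ℕ.*-identityˡ (g [])) (sym (ℕ.*-identityʳ (g [])))
∏-allSubsets-δ {N = suc N} (true ∷ Z)  g = begin
  ∏ (allSubsets (suc N)) (λ X → if does (X ≟ᵛ (true ∷ Z)) then 1 else g X) * g (true ∷ Z)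
    ≡⟨ cong (_* g (true ∷ Z)) (∏-allSubsets-suc N _) ⟩
  (P₁ * P₂) * g (true ∷ Z)               ≡⟨ *.xy∙z≈xz∙y P₁ P₂ (g (true ∷ Z)) ⟩
  (P₁ * g (true ∷ Z)) * P₂               ≡⟨ cong (_* P₂) (∏-allSubsets-δ Z (g ∘ (true ∷_))) ⟩
  ∏ (allSubsets N) (g ∘ (true ∷_)) * P₂  ≡⟨ ∏-allSubsets-suc N g ⟨
  ∏ (allSubsets (suc N)) g               ∎
  where
  open ≡-Reasoning
  P₁ P₂ : ℕ
  P₁ = ∏[ X ∈ allSubsets N ] (if does (X ≟ᵛ Z) then 1 else g (true ∷ X))
  P₂ = ∏[ X ∈ allSubsets N ] g (false ∷ X)
∏-allSubsets-δ {N = suc N} (false ∷ Z) g = begin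
  ∏ (allSubsets (suc N)) (λ X → if does (X ≟ᵛ (false ∷ Z)) then 1 else g X) * g (false ∷ Z)
    ≡⟨ cong (_* g (false ∷ Z)) (∏-allSubsets-suc N _) ⟩
  (P₁ * P₂) * g (false ∷ Z)               ≡⟨ ℕ.*-assoc P₁ P₂ _ ⟩
  P₁ * (P₂ * g (false ∷ Z))               ≡⟨ cong (P₁ *_) (∏-allSubsets-δ Z (g ∘ (false ∷_))) ⟩
  P₁ * ∏ (allSubsets N) (g ∘ (false ∷_))  ≡⟨ ∏-allSubsets-suc N g ⟨
  ∏ (allSubsets (suc N)) g                ∎
  where
  open ≡-Reasoning
  P₁ P₂ : ℕ
  P₁ = ∏[ X ∈ allSubsets N ] g (true ∷ X)
  P₂ = ∏[ X ∈ allSubsets N ] (if does (X ≟ᵛ Z) then 1 else g (false ∷ X))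

∑-allSubsets-bijection : ∀ {N} (ρ ρ⁻¹ : Vec Bool N → Vec Bool N) →
  (∀ X → ρ⁻¹ (ρ X) ≡ X) → (∀ Y → ρ (ρ⁻¹ Y) ≡ Y) →
  ∀ f → ∑[ X ∈ allSubsets N ] f (ρ X) ≡ ∑ (allSubsets N) f
∑-allSubsets-bijection {N} ρ ρ⁻¹ ρ⁻¹ρ≗id ρρ⁻¹≗id f = begin
  ∑[ X ∈ S ] f (ρ X)                                   ≡⟨ ∑-cong S (λ X → ∑-allSubsets-δ (ρ X) f) ⟨
  ∑[ X ∈ S ] ∑[ Y ∈ S ] ind (does (Y ≟ᵛ ρ X)) * f Y    ≡⟨ ∑-comm S S _ ⟩
  ∑[ Y ∈ S ] ∑[ X ∈ S ] ind (does (Y ≟ᵛ ρ X)) * f Y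
    ≡⟨ ∑-cong S (λ Y → ∑-cong S (λ X →
         cong (λ b → ind b * f Y) (does-⇔ (Y≡ρX⇔X≡ρ⁻¹Y X Y) (Y ≟ᵛ ρ X) (X ≟ᵛ ρ⁻¹ Y)))) ⟩
  ∑[ Y ∈ S ] ∑[ X ∈ S ] ind (does (X ≟ᵛ ρ⁻¹ Y)) * f Y
    ≡⟨ ∑-cong S (λ Y → ∑-allSubsets-δ (ρ⁻¹ Y) (λ _ → f Y)) ⟩
  ∑ S f                                                ∎
  where
  open ≡-Reasoning
  S : List (Vec Bool N)
  S = allSubsets N
  Y≡ρX⇔X≡ρ⁻¹Y : ∀ X Y → (Y ≡ ρ X) ⇔ (X ≡ ρ⁻¹ Y)
  Y≡ρX⇔X≡ρ⁻¹Y X Y = mk⇔ (λ { refl → sym (ρ⁻¹ρ≗id X) }) (λ { refl → sym (ρρ⁻¹≗id Y) })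

-- Double counting along the bijection (T , A) ↦ (T ∖ A , A) from the pairs with A ⊆ T to the
-- pairs (H , B) with B ∩ H = ∅, whose inverse is (H , B) ↦ (H ∪ B , B).
∑-⊆-pairs : ∀ N (f : Vec Bool N → Vec Bool N → Vec Bool N → ℕ) →
  ∑[ T ∈ allSubsets N ] ∑[ A ∈ allSubsets N ] ind (A ⊆ᵇ T) * f (T ∖ A) A T ≡
  ∑[ H ∈ allSubsets N ] ∑[ B ∈ allSubsets N ] ind (disjointᵇ B H) * f H B (H ∪ B)
∑-⊆-pairs zero    f = refl
∑-⊆-pairs (suc N) f = begin
  ∑[ T ∈ allSubsets (suc N) ] ∑[ A ∈ allSubsets (suc N) ] ind (A ⊆ᵇ T) * f (T ∖ A) A T
    ≡⟨ ∑²-allSubsets-suc N _ ⟩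
  (L f₁ + L f₂) + ((∑[ T ∈ S ] ∑[ A ∈ S ] 0) + L f₃)
    ≡⟨ cong₂ _+_ (cong₂ _+_ (∑-⊆-pairs N f₁) (∑-⊆-pairs N f₂))
                 (cong₂ _+_ (∑²-zero S S) (∑-⊆-pairs N f₃)) ⟩
  (R f₁ + R f₂) + (0 + R f₃)
    ≡⟨ shuffle (R f₁) (R f₂) (R f₃) ⟩
  (0 + R f₂) + (R f₁ + R f₃)
    ≡⟨ cong (λ z → (z + R f₂) + (R f₁ + R f₃)) (∑²-zero S S) ⟨
  ((∑[ H ∈ S ] ∑[ B ∈ S ] 0) + R f₂) + (R f₁ + R f₃)
    ≡⟨ ∑²-allSubsets-suc N _ ⟨
  ∑[ H ∈ allSubsets (suc N) ] ∑[ B ∈ allSubsets (suc N) ] ind (disjointᵇ B H) * f H B (H ∪ B) ∎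
  where
  open ≡-Reasoning
  S : List (Vec Bool N)
  S = allSubsets N
  L R : (Vec Bool N → Vec Bool N → Vec Bool N → ℕ) → ℕ
  L g = ∑[ T ∈ S ] ∑[ A ∈ S ] ind (A ⊆ᵇ T) * g (T ∖ A) A T
  R g = ∑[ H ∈ S ] ∑[ B ∈ S ] ind (disjointᵇ B H) * g H B (H ∪ B)
  -- f₁, f₂, f₃ are the admissible first coordinates: (T , A) = (1 , 1), (1 , 0), (0 , 0)
  -- on the left and (H , B) = (0 , 1), (1 , 0), (0 , 0) on the right.
  f₁ f₂ f₃ : Vec Bool N → Vec Bool N → Vec Bool N → ℕ
  f₁ H B T = f (false ∷ H) (true ∷ B) (true ∷ T)
  f₂ H B T = f (true ∷ H) (false ∷ B) (true ∷ T)
  f₃ H B T = f (false ∷ H) (false ∷ B) (false ∷ T)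
  shuffle : ∀ a b c → (a + b) + (0 + c) ≡ (0 + b) + (a + c)
  shuffle = solve-∀

∑-subsetsOf : ∀ {N} (X : Vec Bool N) → ∑[ S ∈ allSubsets N ] ind (S ⊆ᵇ X) ≡ 2 ^ countTrue X
∑-subsetsOf             []          = refl
∑-subsetsOf {N = suc N} (true ∷ X)  = trans (∑-allSubsets-suc N (λ S → ind (S ⊆ᵇ (true ∷ X))))
  (cong₂ _+_ (∑-subsetsOf X) (trans (∑-subsetsOf X) (sym (ℕ.+-identityʳ _))))
∑-subsetsOf {N = suc N} (false ∷ X) = trans (∑-allSubsets-suc N (λ S → ind (S ⊆ᵇ (false ∷ X))))
  (cong₂ _+_ (∑-zero (allSubsets N)) (∑-subsetsOf X))

2^-injective : ∀ {a b} → 2 ^ a ≡ 2 ^ b → a ≡ b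
2^-injective {zero}  {zero}  _  = refl
2^-injective {zero}  {suc b} eq = contradiction (sym eq) (ℕ.even≢odd (2 ^ b) 0)
2^-injective {suc a} {zero}  eq = contradiction eq (ℕ.even≢odd (2 ^ a) 0)
2^-injective {suc a} {suc b} eq = cong suc (2^-injective (ℕ.*-cancelˡ-≡ _ _ 2 eq))

⊆ᵇ-sound : ∀ {N} {A B : Vec Bool N} → T (A ⊆ᵇ B) → ∀ i → T (lookup A i) → T (lookup B i)
⊆ᵇ-sound {A = true ∷ _} {true ∷ _} _ zero _ = _
⊆ᵇ-sound {A = a ∷ A}    {b ∷ B}    h (suc i) =
  ⊆ᵇ-sound {A = A} {B} (proj₂ (Equivalence.to (T-∧ {not a ∨ b}) h)) i

⊆ᵇ-complete : ∀ {N} {A B : Vec Bool N} → (∀ i → T (lookup A i) → T (lookup B i)) → T (A ⊆ᵇ B)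
⊆ᵇ-complete {A = []}    {[]}    _ = _
⊆ᵇ-complete {A = a ∷ A} {b ∷ B} h =
  Equivalence.from T-∧ (implies a b (h zero) , ⊆ᵇ-complete {A = A} {B} (h ∘ suc))
  where
  implies : ∀ a b → (T a → T b) → T (not a ∨ b)
  implies false _     _   = _
  implies true  true  _   = _
  implies true  false a⇒b = a⇒b _

disjointᵇ-sound : ∀ {N} {A B : Vec Bool N} → T (disjointᵇ A B) → ∀ i → T (lookup A i) → ¬ T (lookup B i)
disjointᵇ-sound {A = true ∷ _} {true ∷ _} () zero
disjointᵇ-sound {A = a ∷ A}    {b ∷ B}    h (suc i) =
  disjointᵇ-sound {A = A} {B} (proj₂ (Equivalence.to (T-∧ {not (a ∧ b)}) h)) i

disjointᵇ-complete : ∀ {N} {A B : Vec Bool N} → (∀ i → T (lookup A i) → ¬ T (lookup B i)) → T (disjointᵇ A B)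
disjointᵇ-complete {A = []}    {[]}    _ = _
disjointᵇ-complete {A = a ∷ A} {b ∷ B} h =
  Equivalence.from T-∧ (exclusive a b (h zero) , disjointᵇ-complete {A = A} {B} (h ∘ suc))
  where
  exclusive : ∀ a b → (T a → ¬ T b) → T (not (a ∧ b))
  exclusive false _     _    = _
  exclusive true  false _    = _
  exclusive true  true  a⇒¬b = a⇒¬b _ _

permute : ∀ {N} → (Fin N → Fin N) → Vec A N → Vec A N
permute σ X = tabulate (lookup X ∘ σ)

module _ {N : ℕ} (σ : Fin N → Fin N) where

  lookup-permute : ∀ (X : Vec A N) i → lookup (permute σ X) i ≡ lookup X (σ i)
  lookup-permute X = lookup∘tabulate (lookup X ∘ σ)

  permute-zipWith : ∀ (f : Bool → Bool → Bool) X Y →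
    permute σ (zipWith f X Y) ≡ zipWith f (permute σ X) (permute σ Y)
  permute-zipWith f X Y = lookup-ext λ i → begin
    lookup (permute σ (zipWith f X Y)) i                 ≡⟨ lookup-permute (zipWith f X Y) i ⟩
    lookup (zipWith f X Y) (σ i)                         ≡⟨ lookup-zipWith f (σ i) X Y ⟩
    f (lookup X (σ i)) (lookup Y (σ i))                  ≡⟨ cong₂ f (lookup-permute X i) (lookup-permute Y i) ⟨
    f (lookup (permute σ X) i) (lookup (permute σ Y) i)  ≡⟨ lookup-zipWith f i (permute σ X) (permute σ Y) ⟨
    lookup (zipWith f (permute σ X) (permute σ Y)) i     ∎
    where open ≡-Reasoning

  permute-⊆ᵇ : ∀ {A B} → T (A ⊆ᵇ B) → T (permute σ A ⊆ᵇ permute σ B)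
  permute-⊆ᵇ {A} {B} A⊆B = ⊆ᵇ-complete {A = permute σ A} {permute σ B} λ i →
    subst T (sym (lookup-permute B i)) ∘ ⊆ᵇ-sound {A = A} {B} A⊆B (σ i) ∘ subst T (lookup-permute A i)

  permute-disjointᵇ : ∀ {A B} → T (disjointᵇ A B) → T (disjointᵇ (permute σ A) (permute σ B))
  permute-disjointᵇ {A} {B} A∩B≡∅ = disjointᵇ-complete {A = permute σ A} {permute σ B} λ i a b →
    disjointᵇ-sound {A = A} {B} A∩B≡∅ (σ i) (subst T (lookup-permute A i) a) (subst T (lookup-permute B i) b)

record CoordinatePermutation (N : ℕ) : Set where
  field
    σ σ⁻¹         : Fin N → Fin N
    permute-σ⁻¹-σ : ∀ (X : Vec Bool N) → permute σ⁻¹ (permute σ X) ≡ X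
    permute-σ-σ⁻¹ : ∀ (X : Vec Bool N) → permute σ (permute σ⁻¹ X) ≡ X

module CoordinatePermutationProperties {N} (c : CoordinatePermutation N) where
  open CoordinatePermutation c

  ∑-permute : ∀ f → ∑[ X ∈ allSubsets N ] f (permute σ X) ≡ ∑ (allSubsets N) f
  ∑-permute = ∑-allSubsets-bijection (permute σ) (permute σ⁻¹) permute-σ⁻¹-σ permute-σ-σ⁻¹

  ⊆ᵇ-permute : ∀ A B → (permute σ A ⊆ᵇ permute σ B) ≡ (A ⊆ᵇ B)
  ⊆ᵇ-permute A B =
    T-ext (subst₂ (λ A′ B′ → T (A′ ⊆ᵇ B′)) (permute-σ⁻¹-σ A) (permute-σ⁻¹-σ B)
             ∘ permute-⊆ᵇ σ⁻¹ {permute σ A} {permute σ B})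
          (permute-⊆ᵇ σ {A} {B})

  disjointᵇ-permute : ∀ A B → disjointᵇ (permute σ A) (permute σ B) ≡ disjointᵇ A B
  disjointᵇ-permute A B =
    T-ext (subst₂ (λ A′ B′ → T (disjointᵇ A′ B′)) (permute-σ⁻¹-σ A) (permute-σ⁻¹-σ B)
             ∘ permute-disjointᵇ σ⁻¹ {permute σ A} {permute σ B})
          (permute-disjointᵇ σ {A} {B})

  -- Permuting coordinates is an automorphism of the subset lattice, so it preserves the
  -- number 2 ^ ∣ X ∣ of subsets of X.
  countTrue-permute : ∀ X → countTrue (permute σ X) ≡ countTrue X
  countTrue-permute X = 2^-injective (begin
    2 ^ countTrue (permute σ X)
      ≡⟨ ∑-subsetsOf (permute σ X) ⟨
    ∑[ S ∈ allSubsets N ] ind (S ⊆ᵇ permute σ X)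
      ≡⟨ ∑-permute (λ S → ind (S ⊆ᵇ permute σ X)) ⟨
    ∑[ S ∈ allSubsets N ] ind (permute σ S ⊆ᵇ permute σ X)
      ≡⟨ ∑-cong (allSubsets N) (λ S → cong ind (⊆ᵇ-permute S X)) ⟩
    ∑[ S ∈ allSubsets N ] ind (S ⊆ᵇ X)
      ≡⟨ ∑-subsetsOf X ⟩
    2 ^ countTrue X ∎)
    where open ≡-Reasoning

*-cancel-common-multiple : ∀ {W a b c d x y} .{{_ : NonZero W}} →
  a * c ≡ W → b * d ≡ W → d * x ≡ c * y → a * x ≡ b * y
*-cancel-common-multiple {W} {a} {b} {c} {d} {x} {y} ac≡W bd≡W dx≡cy = ℕ.*-cancelˡ-≡ (a * x) (b * y) W (begin
  W * (a * x)        ≡⟨ cong (_* (a * x)) bd≡W ⟨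
  (b * d) * (a * x)  ≡⟨ regroup b d a x ⟩
  (a * b) * (d * x)  ≡⟨ cong ((a * b) *_) dx≡cy ⟩
  (a * b) * (c * y)  ≡⟨ *.interchange a b c y ⟩
  (a * c) * (b * y)  ≡⟨ cong (_* (b * y)) ac≡W ⟩
  W * (b * y)        ∎)
  where
  open ≡-Reasoning
  regroup : ∀ p q r s → (p * q) * (r * s) ≡ (r * p) * (q * s)
  regroup = solve-∀

square-sum-identity : ∀ p q → p * p + q * q ≡ (p * q + p * q) + ∣ p - q ∣ * ∣ p - q ∣
square-sum-identity zero    q       = refl
square-sum-identity (suc p) zero    = zero-case p
  where
  zero-case : ∀ p → suc p * suc p + 0 ≡ (suc p * 0 + suc p * 0) + suc p * suc p
  zero-case = solve-∀
square-sum-identity (suc p) (suc q) = begin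
  suc p * suc p + suc q * suc q                ≡⟨ expand p q ⟩
  (p * p + q * q) + 2 * (1 + p + q)            ≡⟨ cong (_+ 2 * (1 + p + q)) (square-sum-identity p q) ⟩
  ((p * q + p * q) + d * d) + 2 * (1 + p + q)  ≡⟨ collect p q d ⟩
  (suc p * suc q + suc p * suc q) + d * d      ∎
  where
  open ≡-Reasoning
  d : ℕ
  d = ∣ p - q ∣
  expand : ∀ p q → suc p * suc p + suc q * suc q ≡ (p * p + q * q) + 2 * (1 + p + q)
  expand = solve-∀
  collect : ∀ p q d → ((p * q + p * q) + d * d) + 2 * (1 + p + q) ≡ (suc p * suc q + suc p * suc q) + d * d
  collect = solve-∀

∑-balanced-squares⇒≡ : ∀ {A : Set} (xs : List A) (u p q : A → ℕ) → (∀ x → NonZero (u x)) →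
  (∑[ x ∈ xs ] u x * (p x * p x)) + (∑[ x ∈ xs ] u x * (q x * q x)) ≡
    (∑[ x ∈ xs ] u x * (p x * q x)) + (∑[ x ∈ xs ] u x * (p x * q x)) →
  ∀ {x} → x ∈ xs → p x ≡ q x
∑-balanced-squares⇒≡ {A} xs u p q u≢0 balanced {x} x∈ =
  ℕ.∣m-n∣≡0⇒m≡n ([ id , id ]′ (ℕ.m*n≡0⇒m≡0∨n≡0 (d x) dd≡0))
  where
  d cross squares : A → ℕ
  d       x = ∣ p x - q x ∣
  cross   x = u x * (p x * q x) + u x * (p x * q x)
  squares x = u x * (p x * p x) + u x * (q x * q x)
  squares≡cross+ : ∀ x → squares x ≡ cross x + u x * (d x * d x)
  squares≡cross+ x = begin
    u x * (p x * p x) + u x * (q x * q x)              ≡⟨ ℕ.*-distribˡ-+ (u x) _ _ ⟨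
    u x * (p x * p x + q x * q x)                      ≡⟨ cong (u x *_) (square-sum-identity (p x) (q x)) ⟩
    u x * ((p x * q x + p x * q x) + d x * d x)        ≡⟨ ℕ.*-distribˡ-+ (u x) _ _ ⟩
    u x * (p x * q x + p x * q x) + u x * (d x * d x)  ≡⟨ cong (_+ u x * (d x * d x)) (ℕ.*-distribˡ-+ (u x) _ _) ⟩
    cross x + u x * (d x * d x)                        ∎
    where open ≡-Reasoning
  cross≤squares : ∀ x → cross x ≤ squares x
  cross≤squares x = ℕ.≤-trans (ℕ.m≤m+n (cross x) _) (ℕ.≤-reflexive (sym (squares≡cross+ x)))
  ∑cross≡∑squares : ∑ xs cross ≡ ∑ xs squares
  ∑cross≡∑squares = trans (∑-+ xs _ _) (trans (sym balanced) (sym (∑-+ xs _ _)))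
  udd≡0 : u x * (d x * d x) ≡ 0
  udd≡0 = ℕ.+-cancelˡ-≡ (cross x) _ 0 (trans (sym (squares≡cross+ x))
    (trans (sym (∑-mono-≡ cross≤squares ∑cross≡∑squares x∈)) (sym (ℕ.+-identityʳ _))))
  dd≡0 : d x * d x ≡ 0
  dd≡0 = ℕ.*-cancelˡ-≡ _ 0 (u x) {{u≢0 x}} (trans udd≡0 (sym (ℕ.*-zeroʳ (u x))))

EdgeSet : ℕ → Set
EdgeSet n = Vec Bool (numPairs n)

module Graphs (n : ℕ) where

  adjacent : EdgeSet n → Fin n → Fin n → Bool
  adjacent X = adj (mkGraph X)

  EdgeAt : Fin (numPairs n) → Fin n → Fin n → Set
  EdgeAt p a b = List.lookup (pairs n) p ≡ (a , b) ⊎ List.lookup (pairs n) p ≡ (b , a)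

  Ordered : Fin n × Fin n → Set
  Ordered (i , j) = toℕ i < toℕ j

  pairs-ordered : ∀ p → Ordered (List.lookup (pairs n) p)
  pairs-ordered p = proj₂ (∈-filter⁻ (λ q → toℕ (proj₁ q) <? toℕ (proj₂ q))
                                      {xs = cartesianProduct (allFin n) (allFin n)} (∈-lookup p))

  pairs-unique : Unique (pairs n)
  pairs-unique = Unique.filter⁺ _ (Unique.cartesianProduct⁺ (Unique.allFin⁺ n) (Unique.allFin⁺ n))

  pairs-complete : ∀ {a b} → toℕ a < toℕ b → ∃[ p ] List.lookup (pairs n) p ≡ (a , b)
  pairs-complete {a} {b} a<b = index ab∈pairs , sym (lookup-index ab∈pairs)
    where
    ab∈pairs : (a , b) ∈ pairs n
    ab∈pairs = ∈-filter⁺ (λ q → toℕ (proj₁ q) <? toℕ (proj₂ q))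
                         (∈-cartesianProduct⁺ (∈-allFin _) (∈-allFin _)) a<b

  edgeAt-exists : ∀ {a b} → a ≢ b → ∃[ p ] EdgeAt p a b
  edgeAt-exists {a} {b} a≢b with ℕ.<-cmp (toℕ a) (toℕ b)
  ... | tri< a<b _ _ = let p , at = pairs-complete a<b in p , inj₁ at
  ... | tri≈ _ a≡b _ = contradiction (toℕ-injective a≡b) a≢b
  ... | tri> _ _ b<a = let p , at = pairs-complete b<a in p , inj₂ at

  -- The pair test used inside `adj`, so that `adjacent X a b` unfolds to
  -- `anyMarked (joins a b) (pairs n) X`.
  joins : Fin n → Fin n → Fin n × Fin n → Bool
  joins a b (i , j) = (⌊ i ≟ᶠ a ⌋ ∧ ⌊ j ≟ᶠ b ⌋) ∨ (⌊ i ≟ᶠ b ⌋ ∧ ⌊ j ≟ᶠ a ⌋)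

  joins-refl : ∀ {a b} → T (joins a b (a , b))
  joins-refl {a} {b} = Equivalence.from T-∨ (inj₁ (Equivalence.from T-∧
    (fromWitness {a? = a ≟ᶠ a} refl , fromWitness {a? = b ≟ᶠ b} refl)))

  joins-sym : ∀ a b q → joins a b q ≡ joins b a q
  joins-sym a b (i , j) = ∨-comm (⌊ i ≟ᶠ a ⌋ ∧ ⌊ j ≟ᶠ b ⌋) (⌊ i ≟ᶠ b ⌋ ∧ ⌊ j ≟ᶠ a ⌋)

  joins-sound : ∀ {a b} q → T (joins a b q) → q ≡ (a , b) ⊎ q ≡ (b , a)
  joins-sound {a} {b} (i , j) h with Equivalence.to T-∨ h
  ... | inj₁ h₁ = let i≡a , j≡b = Equivalence.to T-∧ h₁
                  in inj₁ (cong₂ _,_ (toWitness {a? = i ≟ᶠ a} i≡a) (toWitness {a? = j ≟ᶠ b} j≡b))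
  ... | inj₂ h₂ = let i≡b , j≡a = Equivalence.to T-∧ h₂
                  in inj₂ (cong₂ _,_ (toWitness {a? = i ≟ᶠ b} i≡b) (toWitness {a? = j ≟ᶠ a} j≡a))

  adjacent-sym : ∀ X a b → adjacent X a b ≡ adjacent X b a
  adjacent-sym X a b = cong or
    (map-cong (λ q → cong (proj₁ q ∧_) (joins-sym a b (proj₂ q))) (zip (toList X) (pairs n)))

  adjacent-irrefl : ∀ X a → adjacent X a a ≡ false
  adjacent-irrefl X a = anyMarked-none (joins a a) (pairs n) X loop-free
    where
    loop-free : ∀ p → ¬ T (joins a a (List.lookup (pairs n) p))
    loop-free p h with joins-sound _ h
    ... | inj₁ aa = ℕ.<-irrefl refl (subst Ordered aa (pairs-ordered p))
    ... | inj₂ aa = ℕ.<-irrefl refl (subst Ordered aa (pairs-ordered p))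

  adjacent-at-ordered : ∀ X {a b} p → List.lookup (pairs n) p ≡ (a , b) → adjacent X a b ≡ lookup X p
  adjacent-at-ordered X {a} {b} p at =
    anyMarked-unique (joins a b) (pairs n) X p (subst (T ∘ joins a b) (sym at) (joins-refl {a} {b})) only-p
    where
    only-p : ∀ q → T (joins a b (List.lookup (pairs n) q)) → q ≡ p
    only-p q h with joins-sound _ h
    ... | inj₁ ab = Unique-lookup-injective pairs-unique (trans ab (sym at))
    ... | inj₂ ba = ⊥-elim (ℕ.<-asym (subst Ordered at (pairs-ordered p)) (subst Ordered ba (pairs-ordered q)))

  adjacent-at : ∀ X {a b p} → EdgeAt p a b → adjacent X a b ≡ lookup X p
  adjacent-at X     (inj₁ at) = adjacent-at-ordered X _ at
  adjacent-at X {a} {b} (inj₂ at) = trans (adjacent-sym X a b) (adjacent-at-ordered X _ at)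

  adjacent-injective : ∀ {X Y} → (∀ a b → adjacent X a b ≡ adjacent Y a b) → X ≡ Y
  adjacent-injective {X} {Y} same = lookup-ext λ p →
    trans (sym (adjacent-at-ordered X p refl)) (trans (same _ _) (adjacent-at-ordered Y p refl))

  endpoints-distinct : (π : Permutation′ n) (p : Fin (numPairs n)) →
    π ⟨$⟩ʳ proj₁ (List.lookup (pairs n) p) ≢ π ⟨$⟩ʳ proj₂ (List.lookup (pairs n) p)
  endpoints-distinct π p eq = ℕ.<-irrefl (cong toℕ (Injection.injective (↔⇒↣ π) eq)) (pairs-ordered p)

  edgeImage : Permutation′ n → Fin (numPairs n) → Fin (numPairs n)
  edgeImage π p = proj₁ (edgeAt-exists (endpoints-distinct π p))

  relabel : Permutation′ n → EdgeSet n → EdgeSet n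
  relabel π = permute (edgeImage π)

  adjacent-relabel : ∀ π X a b → adjacent (relabel π X) a b ≡ adjacent X (π ⟨$⟩ʳ a) (π ⟨$⟩ʳ b)
  adjacent-relabel π X a b with a ≟ᶠ b
  ... | yes refl = trans (adjacent-irrefl (relabel π X) a) (sym (adjacent-irrefl X (π ⟨$⟩ʳ a)))
  ... | no a≢b   = begin
    adjacent (relabel π X) a b                 ≡⟨ adjacent-at (relabel π X) p-ab ⟩
    lookup (relabel π X) p                     ≡⟨ lookup∘tabulate _ p ⟩
    lookup X (edgeImage π p)                   ≡⟨ adjacent-at X (proj₂ (edgeAt-exists (endpoints-distinct π p))) ⟨
    adjacent X (π ⟨$⟩ʳ proj₁ q) (π ⟨$⟩ʳ proj₂ q) ≡⟨ image-endpoints p-ab ⟩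
    adjacent X (π ⟨$⟩ʳ a) (π ⟨$⟩ʳ b)           ∎
    where
    open ≡-Reasoning
    p : Fin (numPairs n)
    p = proj₁ (edgeAt-exists a≢b)
    p-ab : EdgeAt p a b
    p-ab = proj₂ (edgeAt-exists a≢b)
    q : Fin n × Fin n
    q = List.lookup (pairs n) p
    image-endpoints : EdgeAt p a b →
      adjacent X (π ⟨$⟩ʳ proj₁ q) (π ⟨$⟩ʳ proj₂ q) ≡ adjacent X (π ⟨$⟩ʳ a) (π ⟨$⟩ʳ b)
    image-endpoints (inj₁ q≡ab) = cong (λ e → adjacent X (π ⟨$⟩ʳ proj₁ e) (π ⟨$⟩ʳ proj₂ e)) q≡ab
    image-endpoints (inj₂ q≡ba) =
      trans (cong (λ e → adjacent X (π ⟨$⟩ʳ proj₁ e) (π ⟨$⟩ʳ proj₂ e)) q≡ba)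
            (adjacent-sym X (π ⟨$⟩ʳ b) (π ⟨$⟩ʳ a))

  ≡relabel : ∀ X Y π → (∀ a b → adjacent X a b ≡ adjacent Y (π ⟨$⟩ʳ a) (π ⟨$⟩ʳ b)) →
    X ≡ relabel π Y
  ≡relabel X Y π same = adjacent-injective λ a b → trans (same a b) (sym (adjacent-relabel π Y a b))

  relabel-relabel : ∀ π ρ X → relabel π (relabel ρ X) ≡ relabel (π ∘ₚ ρ) X
  relabel-relabel π ρ X = ≡relabel _ X (π ∘ₚ ρ) λ a b →
    trans (adjacent-relabel π (relabel ρ X) a b) (adjacent-relabel ρ X (π ⟨$⟩ʳ a) (π ⟨$⟩ʳ b))

  relabel-inverse : ∀ π ρ X → (∀ a → ρ ⟨$⟩ʳ (π ⟨$⟩ʳ a) ≡ a) → relabel π (relabel ρ X) ≡ X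
  relabel-inverse π ρ X ρπ≗id = adjacent-injective λ a b →
    trans (adjacent-relabel π (relabel ρ X) a b)
          (trans (adjacent-relabel ρ X (π ⟨$⟩ʳ a) (π ⟨$⟩ʳ b)) (cong₂ (adjacent X) (ρπ≗id a) (ρπ≗id b)))

  record _≅_ (X Y : EdgeSet n) : Set where
    constructor iso
    field
      perm : Permutation′ n
      relabels : X ≡ relabel perm Y

  ≅-refl : ∀ {X} → X ≅ X
  ≅-refl {X} = iso Permutation.id (≡relabel X X Permutation.id (λ _ _ → refl))

  ≅-sym : ∀ {X Y} → X ≅ Y → Y ≅ X
  ≅-sym {X} {Y} (iso π X≡πY) =
    iso (flip π) (sym (trans (cong (relabel (flip π)) X≡πY) (relabel-inverse (flip π) π Y (λ _ → inverseʳ π))))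

  ≅-trans : ∀ {X Y Z} → X ≅ Y → Y ≅ Z → X ≅ Z
  ≅-trans {Z = Z} (iso π X≡πY) (iso ρ Y≡ρZ) =
    iso (π ∘ₚ ρ) (trans X≡πY (trans (cong (relabel π) Y≡ρZ) (relabel-relabel π ρ Z)))

  _≅ᵇ_ : EdgeSet n → EdgeSet n → Bool
  X ≅ᵇ Y = isoᵇ {n} (mkGraph X) (mkGraph Y)

  ≅ᵇ-sound : ∀ {X Y} → T (X ≅ᵇ Y) → X ≅ Y
  ≅ᵇ-sound {X} {Y} h with satisfied (any⁻ _ (allMaps n) h)
  ... | f , witness with Equivalence.to T-∧ witness
  ... | injective , preserves =
    iso π (≡relabel X Y π λ a b → ==ᵇ-sound (T-all-allFin⁻ (T-all-allFin⁻ preserves a) b))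
    where
    π : Permutation′ n
    π = injection⇒permutation (lookup f) (injᵇ-sound f injective)

  ≅ᵇ-complete : ∀ {X Y} → X ≅ Y → T (X ≅ᵇ Y)
  ≅ᵇ-complete {X} {Y} (iso π X≡πY) = any⁺ _ (Any.map (λ { refl → witness }) (allVecs-complete ∈-allFin f))
    where
    f : Vec (Fin n) n
    f = tabulate (π ⟨$⟩ʳ_)
    f≗π : ∀ a → lookup f a ≡ π ⟨$⟩ʳ a
    f≗π = lookup∘tabulate _
    preserves : ∀ a b → adjacent X a b ≡ adjacent Y (lookup f a) (lookup f b)
    preserves a b = trans (cong (λ Z → adjacent Z a b) X≡πY)
                          (trans (adjacent-relabel π Y a b) (sym (cong₂ (adjacent Y) (f≗π a) (f≗π b))))
    witness : T (injᵇ f ∧ all (λ a → all (λ b → adjacent X a b ==ᵇ adjacent Y (lookup f a) (lookup f b))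
                                        (allFin n)) (allFin n))
    witness = Equivalence.from T-∧
      ( injᵇ-complete f (λ {a} {b} fa≡fb →
          Injection.injective (↔⇒↣ π) (trans (sym (f≗π a)) (trans fa≡fb (f≗π b))))
      , T-all-allFin⁺ λ a → T-all-allFin⁺ λ b → ==ᵇ-complete (preserves a b))

  ≅ᵇ-sym : ∀ X Y → (X ≅ᵇ Y) ≡ (Y ≅ᵇ X)
  ≅ᵇ-sym X Y = T-ext (λ h → ≅ᵇ-complete {Y} {X} (≅-sym (≅ᵇ-sound {X} {Y} h)))
                     (λ h → ≅ᵇ-complete {X} {Y} (≅-sym (≅ᵇ-sound {Y} {X} h)))

  ≅ᵇ-respˡ : ∀ {X X′} Z → X ≅ X′ → (X ≅ᵇ Z) ≡ (X′ ≅ᵇ Z)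
  ≅ᵇ-respˡ {X} {X′} Z X≅X′ =
    T-ext (λ h → ≅ᵇ-complete {X′} {Z} (≅-trans (≅-sym X≅X′) (≅ᵇ-sound {X} {Z} h)))
          (λ h → ≅ᵇ-complete {X} {Z} (≅-trans X≅X′ (≅ᵇ-sound {X′} {Z} h)))

  ≅ᵇ-respʳ : ∀ {Z Z′} X → Z ≅ Z′ → (X ≅ᵇ Z) ≡ (X ≅ᵇ Z′)
  ≅ᵇ-respʳ {Z} {Z′} X Z≅Z′ =
    trans (≅ᵇ-sym X Z) (trans (≅ᵇ-respˡ {Z} {Z′} X Z≅Z′) (≅ᵇ-sym Z′ X))

  relabel-≅ : ∀ (π : Permutation′ n) (X : EdgeSet n) → relabel π X ≅ X
  relabel-≅ π X = iso π refl

  relabelling : Permutation′ n → CoordinatePermutation (numPairs n)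
  relabelling π = record
    { σ             = edgeImage π
    ; σ⁻¹           = edgeImage (flip π)
    ; permute-σ⁻¹-σ = λ X → relabel-inverse (flip π) π X (λ _ → inverseʳ π)
    ; permute-σ-σ⁻¹ = λ X → relabel-inverse π (flip π) X (λ _ → inverseˡ π)
    }

  ClassFunction : (EdgeSet n → ℕ) → Set
  ClassFunction φ = ∀ {X Y} → X ≅ Y → φ X ≡ φ Y

module Counting (n k : ℕ) where

  open Graphs n

  Subsets : List (EdgeSet n)
  Subsets = allSubsets (numPairs n)

  isKSubsetOf : EdgeSet n → EdgeSet n → Bool
  isKSubsetOf A G = (A ⊆ᵇ G) ∧ (countTrue A ≡ᵇ k)

  down : EdgeSet n → EdgeSet n → ℕ
  down H G = ∑[ A ∈ Subsets ] ind ((A ⊆ᵇ G) ∧ (countTrue A ≡ᵇ k) ∧ (G ∖ A) ≅ᵇ H)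

  up : EdgeSet n → EdgeSet n → ℕ
  up T H = ∑[ B ∈ Subsets ] ind ((countTrue B ≡ᵇ k) ∧ disjointᵇ B H ∧ (H ∪ B) ≅ᵇ T)

  classSize : EdgeSet n → ℕ
  classSize X = ∑[ Y ∈ Subsets ] ind (X ≅ᵇ Y)

  dEntry≡down : ∀ (F G : Graph n) → dEntry k F G ≡ down (edgeSet F) (edgeSet G)
  dEntry≡down F G =
    countL≡∑ind (λ A → (A ⊆ᵇ edgeSet G) ∧ (countTrue A ≡ᵇ k) ∧ (edgeSet G ∖ A) ≅ᵇ edgeSet F) Subsets

  ΔEntry≡∑up : ∀ (T G : EdgeSet n) →
    ΔEntry {n} k (mkGraph T) (mkGraph G) ≡ ∑[ A ∈ Subsets ] ind (isKSubsetOf A G) * up T (G ∖ A)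
  ΔEntry≡∑up T G = ∑-cong Subsets λ A →
    trans (cong (if isKSubsetOf A G then_else 0) (countL≡∑ind (insertion A) Subsets)) (if≡ind* (isKSubsetOf A G) _)
    where
    insertion : EdgeSet n → EdgeSet n → Bool
    insertion A B = (countTrue B ≡ᵇ k) ∧ disjointᵇ B (G ∖ A) ∧ ((G ∖ A) ∪ B) ≅ᵇ T

  module _ (π : Permutation′ n) where
    open CoordinatePermutationProperties (relabelling π)

    down-relabel : ∀ H G → down H (relabel π G) ≡ down H G
    down-relabel H G = trans (sym (∑-permute _)) (∑-cong Subsets λ A →
      cong₂ (λ s t → ind (s ∧ t)) (⊆ᵇ-permute A G)
        (cong₂ (λ c t → (c ≡ᵇ k) ∧ t) (countTrue-permute A)
          (trans (cong (_≅ᵇ H) (sym (permute-zipWith (edgeImage π) _ G A)))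
                 (≅ᵇ-respˡ H (relabel-≅ π (G ∖ A))))))

    up-relabel : ∀ T H → up T (relabel π H) ≡ up T H
    up-relabel T H = trans (sym (∑-permute _)) (∑-cong Subsets λ B →
      cong₂ (λ c t → ind ((c ≡ᵇ k) ∧ t)) (countTrue-permute B)
        (cong₂ _∧_ (disjointᵇ-permute B H)
          (trans (cong (_≅ᵇ T) (sym (permute-zipWith (edgeImage π) _ H B)))
                 (≅ᵇ-respˡ T (relabel-≅ π (H ∪ B))))))

  down-class : ∀ H → ClassFunction (down H)
  down-class H {G} {G′} (iso π G≡πG′) = trans (cong (down H) G≡πG′) (down-relabel π H G′)

  up-class : ∀ T → ClassFunction (up T)
  up-class T {H} {H′} (iso π H≡πH′) = trans (cong (up T) H≡πH′) (up-relabel π T H′)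

  down-classˡ : ∀ G → ClassFunction (λ H → down H G)
  down-classˡ G H≅H′ = ∑-cong Subsets λ A →
    cong (λ b → ind ((A ⊆ᵇ G) ∧ (countTrue A ≡ᵇ k) ∧ b)) (≅ᵇ-respʳ (G ∖ A) H≅H′)

  classSize-class : ClassFunction classSize
  classSize-class X≅X′ = ∑-cong Subsets λ Y → cong ind (≅ᵇ-respˡ Y X≅X′)

  classSize-nonZero : ∀ X → NonZero (classSize X)
  classSize-nonZero X = >-nonZero (subst (_≤ classSize X) (ind-T (≅ᵇ-complete {X = X} {X} ≅-refl))
    (∑-member-≤ (λ Y → ind (X ≅ᵇ Y)) (allSubsets-complete X)))

  ∑-class : ∀ {φ} → ClassFunction φ → ∀ X → ∑[ Y ∈ Subsets ] ind (X ≅ᵇ Y) * φ Y ≡ classSize X * φ X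
  ∑-class {φ} φ-class X = trans (∑-cong Subsets constant-on-class) (∑-*ʳ Subsets (φ X) _)
    where
    constant-on-class : ∀ Y → ind (X ≅ᵇ Y) * φ Y ≡ ind (X ≅ᵇ Y) * φ X
    constant-on-class Y = ind*-cong (X ≅ᵇ Y) (λ X≅Y → sym (φ-class (≅ᵇ-sound {X = X} {Y} X≅Y)))

  -- Both sides count the pairs (G , A) with G ≅ T, A a k-subset of G and G ∖ A ≅ H, grouped
  -- by G on the right and by (G ∖ A , A) on the left.
  double-counting : ∀ T H → classSize H * up T H ≡ classSize T * down H T
  double-counting T H = begin
    classSize H * up T H
      ≡⟨ ∑-class (up-class T) H ⟨
    ∑[ H′ ∈ Subsets ] ind (H ≅ᵇ H′) * up T H′
      ≡⟨ ∑-cong Subsets (λ H′ → trans (sym (∑-*ˡ Subsets (ind (H ≅ᵇ H′)) _))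
                                      (∑-cong Subsets (upTerm H′))) ⟩
    ∑[ H′ ∈ Subsets ] ∑[ B ∈ Subsets ] ind (disjointᵇ B H′) * F H′ B (H′ ∪ B)
      ≡⟨ ∑-⊆-pairs (numPairs n) F ⟨
    ∑[ G ∈ Subsets ] ∑[ A ∈ Subsets ] ind (A ⊆ᵇ G) * F (G ∖ A) A G
      ≡⟨ ∑-cong Subsets (λ G → trans (∑-cong Subsets (downTerm G))
                                     (∑-*ˡ Subsets (ind (T ≅ᵇ G)) _)) ⟩
    ∑[ G ∈ Subsets ] ind (T ≅ᵇ G) * down H G
      ≡⟨ ∑-class (down-class H) T ⟩
    classSize T * down H T ∎
    where
    open ≡-Reasoning
    F : EdgeSet n → EdgeSet n → EdgeSet n → ℕ
    F H′ B G = ind (countTrue B ≡ᵇ k) * (ind (H ≅ᵇ H′) * ind (T ≅ᵇ G))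
    shuffle : ∀ a b c d → a * (b * (c * d)) ≡ c * (b * (a * d))
    shuffle = solve-∀
    upTerm : ∀ H′ B → ind (H ≅ᵇ H′) * ind ((countTrue B ≡ᵇ k) ∧ disjointᵇ B H′ ∧ (H′ ∪ B) ≅ᵇ T) ≡
                      ind (disjointᵇ B H′) * F H′ B (H′ ∪ B)
    upTerm H′ B = begin
      ind (H ≅ᵇ H′) * ind ((countTrue B ≡ᵇ k) ∧ disjointᵇ B H′ ∧ (H′ ∪ B) ≅ᵇ T)
        ≡⟨ cong (ind (H ≅ᵇ H′) *_) (ind-∧³ (countTrue B ≡ᵇ k) (disjointᵇ B H′) ((H′ ∪ B) ≅ᵇ T)) ⟩
      ind (H ≅ᵇ H′) * (ind (countTrue B ≡ᵇ k) * (ind (disjointᵇ B H′) * ind ((H′ ∪ B) ≅ᵇ T)))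
        ≡⟨ shuffle (ind (H ≅ᵇ H′)) (ind (countTrue B ≡ᵇ k)) (ind (disjointᵇ B H′)) _ ⟩
      ind (disjointᵇ B H′) * (ind (countTrue B ≡ᵇ k) * (ind (H ≅ᵇ H′) * ind ((H′ ∪ B) ≅ᵇ T)))
        ≡⟨ cong (λ b → ind (disjointᵇ B H′) * (ind (countTrue B ≡ᵇ k) * (ind (H ≅ᵇ H′) * ind b)))
                (≅ᵇ-sym (H′ ∪ B) T) ⟩
      ind (disjointᵇ B H′) * F H′ B (H′ ∪ B) ∎
    downTerm : ∀ G A → ind (A ⊆ᵇ G) * F (G ∖ A) A G ≡
                       ind (T ≅ᵇ G) * ind ((A ⊆ᵇ G) ∧ (countTrue A ≡ᵇ k) ∧ (G ∖ A) ≅ᵇ H)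
    downTerm G A = begin
      ind (A ⊆ᵇ G) * (ind (countTrue A ≡ᵇ k) * (ind (H ≅ᵇ (G ∖ A)) * ind (T ≅ᵇ G)))
        ≡⟨ cong (λ b → ind (A ⊆ᵇ G) * (ind (countTrue A ≡ᵇ k) * (ind b * ind (T ≅ᵇ G))))
                (≅ᵇ-sym H (G ∖ A)) ⟩
      ind (A ⊆ᵇ G) * (ind (countTrue A ≡ᵇ k) * (ind ((G ∖ A) ≅ᵇ H) * ind (T ≅ᵇ G)))
        ≡⟨ reorder (ind (A ⊆ᵇ G)) (ind (countTrue A ≡ᵇ k)) (ind ((G ∖ A) ≅ᵇ H)) (ind (T ≅ᵇ G)) ⟩
      ind (T ≅ᵇ G) * (ind (A ⊆ᵇ G) * (ind (countTrue A ≡ᵇ k) * ind ((G ∖ A) ≅ᵇ H)))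
        ≡⟨ cong (ind (T ≅ᵇ G) *_) (ind-∧³ (A ⊆ᵇ G) (countTrue A ≡ᵇ k) ((G ∖ A) ≅ᵇ H)) ⟨
      ind (T ≅ᵇ G) * ind ((A ⊆ᵇ G) ∧ (countTrue A ≡ᵇ k) ∧ (G ∖ A) ≅ᵇ H) ∎
      where
      reorder : ∀ a b c d → a * (b * (c * d)) ≡ d * (a * (b * c))
      reorder = solve-∀

  W : ℕ
  W = ∏ Subsets classSize

  cofactor : EdgeSet n → ℕ
  cofactor X = ∏[ Y ∈ Subsets ] (if does (Y ≟ᵛ X) then 1 else classSize Y)

  cofactor*classSize : ∀ X → cofactor X * classSize X ≡ W
  cofactor*classSize X = ∏-allSubsets-δ X classSize

  W-nonZero : NonZero W
  W-nonZero = ∏-nonZero Subsets classSize-nonZero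

  cofactor-nonZero : ∀ X → NonZero (cofactor X)
  cofactor-nonZero X = ∏-nonZero Subsets factor≢0
    where
    factor≢0 : ∀ Y → NonZero (if does (Y ≟ᵛ X) then 1 else classSize Y)
    factor≢0 Y with does (Y ≟ᵛ X)
    ... | true  = _
    ... | false = classSize-nonZero Y

  cofactor-class : ClassFunction cofactor
  cofactor-class {X} {X′} X≅X′ = ℕ.*-cancelʳ-≡ _ _ (classSize X) {{classSize-nonZero X}} (begin
    cofactor X * classSize X    ≡⟨ cofactor*classSize X ⟩
    W                           ≡⟨ cofactor*classSize X′ ⟨
    cofactor X′ * classSize X′  ≡⟨ cong (cofactor X′ *_) (classSize-class X≅X′) ⟨
    cofactor X′ * classSize X   ∎)
    where open ≡-Reasoning

  weighted-double-counting : ∀ T H → cofactor T * up T H ≡ cofactor H * down H T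
  weighted-double-counting T H =
    *-cancel-common-multiple {W} {cofactor T} {cofactor H} {classSize T} {classSize H} {up T H} {down H T}
                             {{W-nonZero}} (cofactor*classSize T) (cofactor*classSize H) (double-counting T H)

  deck : List (Graph n) → EdgeSet n → ℕ
  deck R H = ∑[ G ∈ R ] down H (edgeSet G)

  dX≡deck : ∀ (R : List (Graph n)) (F : Graph n) → dX k R F ≡ deck R (edgeSet F)
  dX≡deck R F = ∑-cong R (λ G → dEntry≡down F G)

  weight : EdgeSet n → ℕ
  weight H = cofactor H * cofactor H

  weight-nonZero : ∀ H → NonZero (weight H)
  weight-nonZero H = ℕ.m*n≢0 _ _ {{cofactor-nonZero H}} {{cofactor-nonZero H}}

  pairing : List (Graph n) → List (Graph n) → ℕ
  pairing P R = ∑[ H ∈ Subsets ] weight H * (deck P H * deck R H)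

  pairing-comm : ∀ (P R : List (Graph n)) → pairing P R ≡ pairing R P
  pairing-comm P R = ∑-cong Subsets λ H → cong (weight H *_) (ℕ.*-comm (deck P H) (deck R H))

  ∑-cofactor*ΔEntry : ∀ (R : List (Graph n)) (G : EdgeSet n) →
    ∑[ T ∈ R ] cofactor (edgeSet T) * ΔEntry k T (mkGraph G) ≡
    ∑[ A ∈ Subsets ] ind (isKSubsetOf A G) * (cofactor (G ∖ A) * deck R (G ∖ A))
  ∑-cofactor*ΔEntry R G = begin
    ∑[ T ∈ R ] cofactor (edgeSet T) * ΔEntry k T (mkGraph G)
      ≡⟨ ∑-cong R (λ T → cong (cofactor (edgeSet T) *_) (ΔEntry≡∑up (edgeSet T) G)) ⟩
    ∑[ T ∈ R ] cofactor (edgeSet T) * (∑[ A ∈ Subsets ] ind (isKSubsetOf A G) * up (edgeSet T) (G ∖ A))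
      ≡⟨ ∑-cong R (λ T → trans (sym (∑-*ˡ Subsets (cofactor (edgeSet T)) _))
                               (∑-cong Subsets (weighted-term T))) ⟩
    ∑[ T ∈ R ] ∑[ A ∈ Subsets ] ind (isKSubsetOf A G) * (cofactor (G ∖ A) * down (G ∖ A) (edgeSet T))
      ≡⟨ ∑-comm R Subsets _ ⟩
    ∑[ A ∈ Subsets ] ∑[ T ∈ R ] ind (isKSubsetOf A G) * (cofactor (G ∖ A) * down (G ∖ A) (edgeSet T))
      ≡⟨ ∑-cong Subsets (λ A → trans (∑-*ˡ R (ind (isKSubsetOf A G)) _)
                                     (cong (ind (isKSubsetOf A G) *_) (∑-*ˡ R (cofactor (G ∖ A)) _))) ⟩
    ∑[ A ∈ Subsets ] ind (isKSubsetOf A G) * (cofactor (G ∖ A) * deck R (G ∖ A)) ∎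
    where
    open ≡-Reasoning
    weighted-term : ∀ T A → cofactor (edgeSet T) * (ind (isKSubsetOf A G) * up (edgeSet T) (G ∖ A)) ≡
                            ind (isKSubsetOf A G) * (cofactor (G ∖ A) * down (G ∖ A) (edgeSet T))
    weighted-term T A =
      trans (*.x∙yz≈y∙xz (cofactor (edgeSet T)) (ind (isKSubsetOf A G)) (up (edgeSet T) (G ∖ A)))
            (cong (ind (isKSubsetOf A G) *_) (weighted-double-counting (edgeSet T) (G ∖ A)))

  ∑-down*classFunction : ∀ {φ} → ClassFunction φ → ∀ G →
    ∑[ H ∈ Subsets ] down H G * φ H ≡
    ∑[ A ∈ Subsets ] ind (isKSubsetOf A G) * (classSize (G ∖ A) * φ (G ∖ A))
  ∑-down*classFunction {φ} φ-class G = begin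
    ∑[ H ∈ Subsets ] down H G * φ H
      ≡⟨ ∑-cong Subsets (λ H → trans (sym (∑-*ʳ Subsets (φ H) _)) (∑-cong Subsets (split H))) ⟩
    ∑[ H ∈ Subsets ] ∑[ A ∈ Subsets ] ind (isKSubsetOf A G) * (ind ((G ∖ A) ≅ᵇ H) * φ H)
      ≡⟨ ∑-comm Subsets Subsets _ ⟩
    ∑[ A ∈ Subsets ] ∑[ H ∈ Subsets ] ind (isKSubsetOf A G) * (ind ((G ∖ A) ≅ᵇ H) * φ H)
      ≡⟨ ∑-cong Subsets (λ A → trans (∑-*ˡ Subsets (ind (isKSubsetOf A G)) _)
                                     (cong (ind (isKSubsetOf A G) *_) (∑-class φ-class (G ∖ A)))) ⟩
    ∑[ A ∈ Subsets ] ind (isKSubsetOf A G) * (classSize (G ∖ A) * φ (G ∖ A)) ∎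
    where
    open ≡-Reasoning
    split : ∀ H A → ind ((A ⊆ᵇ G) ∧ (countTrue A ≡ᵇ k) ∧ (G ∖ A) ≅ᵇ H) * φ H ≡
                    ind (isKSubsetOf A G) * (ind ((G ∖ A) ≅ᵇ H) * φ H)
    split H A = begin
      ind ((A ⊆ᵇ G) ∧ (countTrue A ≡ᵇ k) ∧ (G ∖ A) ≅ᵇ H) * φ H
        ≡⟨ cong (_* φ H) (ind-∧³ (A ⊆ᵇ G) (countTrue A ≡ᵇ k) ((G ∖ A) ≅ᵇ H)) ⟩
      (ind (A ⊆ᵇ G) * (ind (countTrue A ≡ᵇ k) * ind ((G ∖ A) ≅ᵇ H))) * φ H
        ≡⟨ regroup (ind (A ⊆ᵇ G)) _ _ _ ⟩
      (ind (A ⊆ᵇ G) * ind (countTrue A ≡ᵇ k)) * (ind ((G ∖ A) ≅ᵇ H) * φ H)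
        ≡⟨ cong (_* (ind ((G ∖ A) ≅ᵇ H) * φ H)) (ind-∧ (A ⊆ᵇ G) _) ⟨
      ind (isKSubsetOf A G) * (ind ((G ∖ A) ≅ᵇ H) * φ H) ∎
      where
      regroup : ∀ a b c d → (a * (b * c)) * d ≡ (a * b) * (c * d)
      regroup = solve-∀

  W*∑cofactor*ΔX≡pairing : ∀ (P R : List (Graph n)) →
    W * (∑[ T ∈ R ] cofactor (edgeSet T) * ΔX k P T) ≡ pairing P R
  W*∑cofactor*ΔX≡pairing P R = begin
    W * (∑[ T ∈ R ] cofactor (edgeSet T) * ΔX k P T)
      ≡⟨ cong (W *_) (∑-cong R (λ T → sym (∑-*ˡ P (cofactor (edgeSet T)) (ΔEntry k T)))) ⟩
    W * (∑[ T ∈ R ] ∑[ G ∈ P ] cofactor (edgeSet T) * ΔEntry k T G)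
      ≡⟨ cong (W *_) (∑-comm R P _) ⟩
    W * (∑[ G ∈ P ] ∑[ T ∈ R ] cofactor (edgeSet T) * ΔEntry k T G)
      ≡⟨ ∑-*ˡ P W _ ⟨
    ∑[ G ∈ P ] W * (∑[ T ∈ R ] cofactor (edgeSet T) * ΔEntry k T G)
      ≡⟨ ∑-cong P (λ G → cong (W *_) (∑-cofactor*ΔEntry R (edgeSet G))) ⟩
    ∑[ G ∈ P ] W * (∑[ A ∈ Subsets ] sel G A * (cofactor (edgeSet G ∖ A) * deck R (edgeSet G ∖ A)))
      ≡⟨ ∑-cong P (λ G → trans (sym (∑-*ˡ Subsets W _))
                               (∑-cong Subsets (λ A → rescale (sel G A) (edgeSet G ∖ A)))) ⟩
    ∑[ G ∈ P ] ∑[ A ∈ Subsets ] sel G A * (classSize (edgeSet G ∖ A) * ψ (edgeSet G ∖ A))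
      ≡⟨ ∑-cong P (λ G → ∑-down*classFunction ψ-class (edgeSet G)) ⟨
    ∑[ G ∈ P ] ∑[ H ∈ Subsets ] down H (edgeSet G) * ψ H
      ≡⟨ ∑-comm P Subsets _ ⟩
    ∑[ H ∈ Subsets ] ∑[ G ∈ P ] down H (edgeSet G) * ψ H
      ≡⟨ ∑-cong Subsets (λ H → trans (∑-*ʳ P (ψ H) _) (*.x∙yz≈y∙xz (deck P H) (weight H) (deck R H))) ⟩
    pairing P R ∎
    where
    open ≡-Reasoning
    sel : Graph n → EdgeSet n → ℕ
    sel G A = ind (isKSubsetOf A (edgeSet G))
    ψ : EdgeSet n → ℕ
    ψ H = weight H * deck R H
    ψ-class : ClassFunction ψ
    ψ-class X≅Y = cong₂ _*_ (cong₂ _*_ (cofactor-class X≅Y) (cofactor-class X≅Y))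
                            (∑-cong R (λ G → down-classˡ (edgeSet G) X≅Y))
    rescale : ∀ s H → W * (s * (cofactor H * deck R H)) ≡ s * (classSize H * ψ H)
    rescale s H = begin
      W * (s * (cofactor H * deck R H))
        ≡⟨ cong (_* (s * (cofactor H * deck R H))) (cofactor*classSize H) ⟨
      (cofactor H * classSize H) * (s * (cofactor H * deck R H))
        ≡⟨ reorder (cofactor H) (classSize H) s (deck R H) ⟩
      s * (classSize H * ψ H) ∎
      where
      reorder : ∀ f c s d → (f * c) * (s * (f * d)) ≡ s * (c * ((f * f) * d))
      reorder = solve-∀

theorem2p6 : (n m k : ℕ) → 1 ≤ n → m ≤ n C 2 → 1 ≤ k →
    (P Q : List (Graph n)) →
    All (λ G → edges G ≡ m) P → All (λ G → edges G ≡ m) Q →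
    (∀ (F : Graph n) → edges F ≡ m → ΔX k P F ≡ ΔX k Q F) →
    ∀ (F : Graph n) → edges F ≡ m ∸ k → dX k P F ≡ dX k Q F
theorem2p6 n m k _ _ _ P Q P-edges Q-edges ΔP≡ΔQ F _ = begin
  dX k P F            ≡⟨ dX≡deck P F ⟩
  deck P (edgeSet F)  ≡⟨ ∑-balanced-squares⇒≡ Subsets weight (deck P) (deck Q) weight-nonZero balanced
                                              (allSubsets-complete (edgeSet F)) ⟩
  deck Q (edgeSet F)  ≡⟨ dX≡deck Q F ⟨
  dX k Q F            ∎
  where
  open Graphs n
  open Counting n k
  open ≡-Reasoning
  pairing-P≡pairing-Q : ∀ R → All (λ G → edges G ≡ m) R → pairing P R ≡ pairing Q R
  pairing-P≡pairing-Q R R-edges = begin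
    pairing P R                                       ≡⟨ W*∑cofactor*ΔX≡pairing P R ⟨
    W * (∑[ T ∈ R ] cofactor (edgeSet T) * ΔX k P T)  ≡⟨ cong (W *_) (∑-congᴬ (All.map weighted R-edges)) ⟩
    W * (∑[ T ∈ R ] cofactor (edgeSet T) * ΔX k Q T)  ≡⟨ W*∑cofactor*ΔX≡pairing Q R ⟩
    pairing Q R                                       ∎
    where
    weighted : ∀ {T} → edges T ≡ m → cofactor (edgeSet T) * ΔX k P T ≡ cofactor (edgeSet T) * ΔX k Q T
    weighted {T} = cong (cofactor (edgeSet T) *_) ∘ ΔP≡ΔQ T
  balanced : pairing P P + pairing Q Q ≡ pairing P Q + pairing P Q
  balanced = cong₂ _+_ (trans (pairing-P≡pairing-Q P P-edges) (pairing-comm Q P))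
                       (sym (pairing-P≡pairing-Q Q Q-edges))
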